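{- Let $D=(V,A)$ be a DAG. Then every weak directed intersection representation of $D$ is a directed intersection representation of $D$. Moreover, if $D$ is Hamiltonian, then every directed intersection representation of $D$ is a weak directed intersection representation of $D$, and $\mathrm{din}(D)=\mathrm{wdin}(D)$.
   Context: A DAG is a finite directed acyclic graph without loops or multiple arcs; it is Hamiltonian if it has a directed path containing every vertex. A directed intersection representation of $D=(V,A)$ is a pair $(U,\varphi)$, $U$ finite, $\varphi(v)\subseteq U$, such that for all $u,v\in V$: $(u,v)\in A$ iff $\varphi(u)\cap\varphi(v)\neq\emptyset$ and $|\varphi(u)|<|\varphi(v)|$; $\mathrm{din}(D)$ is the minimum $|U|$ of such a representation. A weak directed intersection representation is a pair $(U,\varphi)$ such that for any two distinct $u,v\in V$: $(u,v)\in A$ iff $\varphi(u)\cap\varphi(v)\neq\emptyset$ and $|\varphi(u)|\le|\varphi(v)|$; $\mathrm{wdin}(D)$ is the minimum $|U|$ of such a representation. -}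

module Defs where

open import Level using (0ℓ)
open import Data.Nat using (ℕ; suc; _<_; _≤_)
open import Data.Fin using (Fin; toℕ)
open import Data.Fin.Subset using (Subset; _∩_; ∣_∣; Nonempty)
open import Data.Fin.Permutation using (Permutation′; _⟨$⟩ʳ_)
open import Data.Product using (Σ; ∃; _×_)
open import Data.Empty using (⊥)
open import Relation.Nullary using (¬_)
open import Relation.Binary.PropositionalEquality using (_≡_)
open import Relation.Binary.Construct.Closure.Transitive using (TransClosure)
open import Function.Bundles using (_⇔_)

record Digraph : Set₁ where
  field
    n   : ℕ
    Arc : Fin n → Fin n → Set
open Digraph public

IsDAG : Digraph → Set
IsDAG D = ∀ v → ¬ TransClosure (Arc D) v v

Hamiltonian : Digraph → Set
Hamiltonian D = Σ (Permutation′ (n D)) λ π →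
  ∀ (i j : Fin (n D)) → toℕ j ≡ suc (toℕ i) → Arc D (π ⟨$⟩ʳ i) (π ⟨$⟩ʳ j)

Assignment : Digraph → ℕ → Set
Assignment D m = Fin (n D) → Subset m

IsDirRep : (D : Digraph) (m : ℕ) → Assignment D m → Set
IsDirRep D m φ = ∀ (u v : Fin (n D)) →
  Arc D u v ⇔ (Nonempty (φ u ∩ φ v) × ∣ φ u ∣ < ∣ φ v ∣)

IsWeakDirRep : (D : Digraph) (m : ℕ) → Assignment D m → Set
IsWeakDirRep D m φ = ∀ (u v : Fin (n D)) → ¬ (u ≡ v) →
  (Arc D u v ⇔ (Nonempty (φ u ∩ φ v) × ∣ φ u ∣ ≤ ∣ φ v ∣))

IsDin : Digraph → ℕ → Set
IsDin D k = (∃ λ (φ : Assignment D k) → IsDirRep D k φ)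
          × (∀ m (φ : Assignment D m) → IsDirRep D m φ → k ≤ m)

IsWdin : Digraph → ℕ → Set
IsWdin D k = (∃ λ (φ : Assignment D k) → IsWeakDirRep D k φ)
           × (∀ m (φ : Assignment D m) → IsWeakDirRep D m φ → k ≤ m)

{-# OPTIONS --safe #-}
-- In a weak representation an arc u → v with ∣ φ u ∣ ≡ ∣ φ v ∣ would force the
-- arc v → u too, closing a 2-cycle; so in a DAG the weak condition is the strict
-- one. Conversely, in a representation the set sizes strictly increase along a
-- Hamiltonian path, so distinct vertices have distinct sizes and ≤ agrees with <.
-- As both notions then have the same representations, din and wdin coincide.
module Submission where

open import Defs
open import Data.Nat using (ℕ; suc; _<_; _≤_; s≤s⁻¹)
open import Data.Nat.Properties using (<-irrefl; ≤-<-trans; <⇒≤; ≤-reflexive; m≤n⇒m<n∨m≡n)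
open import Data.Fin as Fin using (Fin; toℕ; inject₁)
open import Data.Fin.Induction using (<-weakInduction)
open import Data.Fin.Properties using (toℕ-inject₁; toℕ-injective; <-cmp; _≟_)
open import Data.Fin.Subset using (Subset; _∩_; ∣_∣; Nonempty)
open import Data.Fin.Subset.Properties using (∩-comm)
open import Data.Fin.Permutation using (_⟨$⟩ʳ_; _⟨$⟩ˡ_; inverseʳ)
open import Data.Product using (_×_; _,_; proj₂)
open import Data.Sum using (inj₁; inj₂)
open import Function.Base using (_∘_)
open import Function.Bundles using (_⇔_; mk⇔; Equivalence)
open import Function.Definitions using (Injective)
open import Relation.Binary.Definitions using (tri<; tri≈; tri>)
open import Relation.Binary.PropositionalEquality
  using (_≡_; refl; sym; cong; subst; module ≡-Reasoning)
open import Relation.Binary.Construct.Closure.Transitive using ([_]; _∷_)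
open import Relation.Nullary using (yes; no; contradiction)

nonempty-∩-comm : ∀ {m} (p q : Subset m) → Nonempty (p ∩ q) → Nonempty (q ∩ p)
nonempty-∩-comm p q = subst Nonempty (∩-comm p q)

isWeakDirRep⇒isDirRep : (D : Digraph) → IsDAG D →
  (m : ℕ) (φ : Assignment D m) → IsWeakDirRep D m φ → IsDirRep D m φ
isWeakDirRep⇒isDirRep D acyclic m φ weak u v with u ≟ v
... | yes refl = mk⇔ (λ uu → contradiction [ uu ] (acyclic u))
                     (λ (_ , size<) → contradiction size< (<-irrefl refl))
... | no u≢v = mk⇔ to from
  where
  from : Nonempty (φ u ∩ φ v) × ∣ φ u ∣ < ∣ φ v ∣ → Arc D u v
  from (meet , size<) = Equivalence.from (weak u v u≢v) (meet , <⇒≤ size<)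

  to : Arc D u v → Nonempty (φ u ∩ φ v) × ∣ φ u ∣ < ∣ φ v ∣
  to uv with Equivalence.to (weak u v u≢v) uv
  ... | meet , size≤ with m≤n⇒m<n∨m≡n size≤
  ...   | inj₁ size< = meet , size<
  ...   | inj₂ size≡ = contradiction (uv ∷ [ vu ]) (acyclic u)
    where
    vu : Arc D v u
    vu = Equivalence.from (weak v u (u≢v ∘ sym))
           (nonempty-∩-comm (φ u) (φ v) meet , ≤-reflexive (sym size≡))

stepwise-<⇒strictlyMonotone : ∀ {n} (f : Fin n → ℕ) →
  (∀ i j → toℕ j ≡ suc (toℕ i) → f i < f j) →
  ∀ {i j} → i Fin.< j → f i < f j
stepwise-<⇒strictlyMonotone {suc n} f step {i} {j} = <-weakInduction P base next j i
  where
  P : Fin (suc n) → Set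
  P j = ∀ i → i Fin.< j → f i < f j

  base : P Fin.zero
  base i ()

  next : ∀ j → P (inject₁ j) → P (Fin.suc j)
  next j ih i i<1+j = ≤-<-trans fi≤fj (step (inject₁ j) (Fin.suc j) (cong suc (sym (toℕ-inject₁ j))))
    where
    i≤inject₁j : toℕ i ≤ toℕ (inject₁ j)
    i≤inject₁j = subst (toℕ i ≤_) (sym (toℕ-inject₁ j)) (s≤s⁻¹ i<1+j)

    fi≤fj : f i ≤ f (inject₁ j)
    fi≤fj with m≤n⇒m<n∨m≡n i≤inject₁j
    ... | inj₁ i<j = <⇒≤ (ih i i<j)
    ... | inj₂ i≡j = ≤-reflexive (cong f (toℕ-injective i≡j))

strictlyMonotone⇒injective : ∀ {n} (f : Fin n → ℕ) →
  (∀ {i j} → i Fin.< j → f i < f j) → Injective _≡_ _≡_ f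
strictlyMonotone⇒injective f mono {i} {j} fi≡fj with <-cmp i j
... | tri< i<j _ _ = contradiction (mono i<j) (<-irrefl fi≡fj)
... | tri≈ _ i≡j _ = i≡j
... | tri> _ _ j<i = contradiction (mono j<i) (<-irrefl (sym fi≡fj))

hamiltonian⇒size-injective : (D : Digraph) → Hamiltonian D →
  (m : ℕ) (φ : Assignment D m) → IsDirRep D m φ → Injective _≡_ _≡_ (∣_∣ ∘ φ)
hamiltonian⇒size-injective D (π , path) m φ rep {u} {v} size≡ = begin
  u                         ≡⟨ inverseʳ π ⟨
  π ⟨$⟩ʳ (π ⟨$⟩ˡ u)         ≡⟨ cong (π ⟨$⟩ʳ_) (size-along-path-injective size≡′) ⟩
  π ⟨$⟩ʳ (π ⟨$⟩ˡ v)         ≡⟨ inverseʳ π ⟩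
  v                         ∎
  where
  open ≡-Reasoning

  size-along-path : Fin (n D) → ℕ
  size-along-path = ∣_∣ ∘ φ ∘ (π ⟨$⟩ʳ_)

  size-along-path-injective : Injective _≡_ _≡_ size-along-path
  size-along-path-injective = strictlyMonotone⇒injective size-along-path
    (stepwise-<⇒strictlyMonotone size-along-path
      (λ i j j≡1+i → proj₂ (Equivalence.to (rep _ _) (path i j j≡1+i))))

  size≡′ : size-along-path (π ⟨$⟩ˡ u) ≡ size-along-path (π ⟨$⟩ˡ v)
  size≡′ = begin
    ∣ φ (π ⟨$⟩ʳ (π ⟨$⟩ˡ u)) ∣  ≡⟨ cong (∣_∣ ∘ φ) (inverseʳ π) ⟩
    ∣ φ u ∣                    ≡⟨ size≡ ⟩
    ∣ φ v ∣                    ≡⟨ cong (∣_∣ ∘ φ) (inverseʳ π) ⟨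
    ∣ φ (π ⟨$⟩ʳ (π ⟨$⟩ˡ v)) ∣  ∎

size-injective∧isDirRep⇒isWeakDirRep : (D : Digraph) (m : ℕ) (φ : Assignment D m) →
  Injective _≡_ _≡_ (∣_∣ ∘ φ) → IsDirRep D m φ → IsWeakDirRep D m φ
size-injective∧isDirRep⇒isWeakDirRep D m φ size-injective rep u v u≢v = mk⇔ to from
  where
  to : Arc D u v → Nonempty (φ u ∩ φ v) × ∣ φ u ∣ ≤ ∣ φ v ∣
  to uv with Equivalence.to (rep u v) uv
  ... | meet , size< = meet , <⇒≤ size<

  from : Nonempty (φ u ∩ φ v) × ∣ φ u ∣ ≤ ∣ φ v ∣ → Arc D u v
  from (meet , size≤) with m≤n⇒m<n∨m≡n size≤
  ... | inj₁ size< = Equivalence.from (rep u v) (meet , size<)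
  ... | inj₂ size≡ = contradiction (size-injective size≡) u≢v

isDin⇔isWdin : (D : Digraph) →
  ((m : ℕ) (φ : Assignment D m) → IsDirRep D m φ → IsWeakDirRep D m φ) →
  ((m : ℕ) (φ : Assignment D m) → IsWeakDirRep D m φ → IsDirRep D m φ) →
  (k : ℕ) → IsDin D k ⇔ IsWdin D k
isDin⇔isWdin D dir⇒weak weak⇒dir k = mk⇔
  (λ ((φ , rep) , minimal) → (φ , dir⇒weak k φ rep) , λ m ψ weak → minimal m ψ (weak⇒dir m ψ weak))
  (λ ((φ , weak) , minimal) → (φ , weak⇒dir k φ weak) , λ m ψ rep → minimal m ψ (dir⇒weak m ψ rep))

lemma6 : (D : Digraph) → IsDAG D →
    ((m : ℕ) (φ : Assignment D m) → IsWeakDirRep D m φ → IsDirRep D m φ)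
    × (Hamiltonian D →
        ((m : ℕ) (φ : Assignment D m) → IsDirRep D m φ → IsWeakDirRep D m φ)
        × ((k : ℕ) → IsDin D k ⇔ IsWdin D k))
lemma6 D acyclic = weak⇒dir , λ ham → dir⇒weak ham , isDin⇔isWdin D (dir⇒weak ham) weak⇒dir
  where
  weak⇒dir : (m : ℕ) (φ : Assignment D m) → IsWeakDirRep D m φ → IsDirRep D m φ
  weak⇒dir = isWeakDirRep⇒isDirRep D acyclic

  dir⇒weak : Hamiltonian D →
    (m : ℕ) (φ : Assignment D m) → IsDirRep D m φ → IsWeakDirRep D m φ
  dir⇒weak ham m φ rep =
    size-injective∧isDirRep⇒isWeakDirRep D m φ (hamiltonian⇒size-injective D ham m φ rep) rep
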